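{- Let $G$ be a finite graph with vertex set $V$ that is lefthanded with respect to a tree order $\leq$ on $V$. For $v\in V$ let $D_v:=\{u\in V: u\lneq v\}$, $N_v:=\{u\in D_v: u\sim v\}$, $F_v:=D_v\setminus N_v$, and for $U\subseteq V$ let $\mu(U):=\{u\in U: \text{there is no } w\in U \text{ with } u\lneq w\}$ be the set of maximal elements of $U$. Then for every $v\in V$, \[ \mu(D_v)\cup\bigcup_{u\in N_v}\mu(D_u)=N_v\cup\mu(F_v), \] where the sets $\mu(D_v)$ and $\mu(D_u)$ ($u\in N_v$) on the left are pairwise disjoint, and $N_v$ and $\mu(F_v)$ on the right are disjoint.
   Context: A tree order is a partial order $\leq$ in which $w\lneq u$ and $w\lneq v$ imply that $u$ and $v$ are comparable. A graph $G$ is lefthanded with respect to a tree order $\leq$ on $V(G)$ if (1) $u\sim v$ implies $u\leq v$ or $v\leq u$, and (2) whenever $w\lneq u\lneq v$ and $v\sim w$, also $v\sim u$. -}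

module Defs where

open import Data.Fin using (Fin)
open import Data.Nat using (ℕ)
open import Data.Product using (_×_; Σ; ∃)
open import Data.Sum using (_⊎_)
open import Relation.Nullary using (¬_)
open import Relation.Binary.PropositionalEquality using (_≡_; _≢_)
open import Relation.Binary.Structures using (IsPartialOrder)

Rel : ℕ → Set₁
Rel n = Fin n → Fin n → Set

VSet : ℕ → Set₁
VSet n = Fin n → Set

Strict : ∀ {n} → Rel n → Rel n
Strict _≤_ u v = (u ≤ v) × (u ≢ v)

IsTreeOrder : ∀ {n} → Rel n → Set
IsTreeOrder {n} _≤_ =
  IsPartialOrder _≡_ _≤_ ×
  (∀ (w u v : Fin n) → Strict _≤_ w u → Strict _≤_ w v → (u ≤ v) ⊎ (v ≤ u))

IsGraph : ∀ {n} → Rel n → Set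
IsGraph {n} _∼_ = (∀ (u v : Fin n) → u ∼ v → v ∼ u) × (∀ (u : Fin n) → ¬ (u ∼ u))

IsLefthanded : ∀ {n} → Rel n → Rel n → Set
IsLefthanded {n} _≤_ _∼_ =
  (∀ (u v : Fin n) → u ∼ v → (u ≤ v) ⊎ (v ≤ u)) ×
  (∀ (w u v : Fin n) → Strict _≤_ w u → Strict _≤_ u v → v ∼ w → v ∼ u)

D : ∀ {n} → Rel n → Fin n → VSet n
D _≤_ v u = Strict _≤_ u v

N : ∀ {n} → Rel n → Rel n → Fin n → VSet n
N _≤_ _∼_ v u = D _≤_ v u × (u ∼ v)

F : ∀ {n} → Rel n → Rel n → Fin n → VSet n
F _≤_ _∼_ v u = D _≤_ v u × ¬ N _≤_ _∼_ v u

μ : ∀ {n} → Rel n → VSet n → VSet n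
μ {n} _≤_ U u = U u × ¬ (Σ (Fin n) λ w → U w × Strict _≤_ u w)

_≐_ : ∀ {n} → VSet n → VSet n → Set
_≐_ {n} A B = ∀ (x : Fin n) → (A x → B x) × (B x → A x)

Disjoint : ∀ {n} → VSet n → VSet n → Set
Disjoint {n} A B = ∀ (x : Fin n) → ¬ (A x × B x)

LHS : ∀ {n} → Rel n → Rel n → Fin n → VSet n
LHS {n} _≤_ _∼_ v x = μ _≤_ (D _≤_ v) x ⊎ (Σ (Fin n) λ u → N _≤_ _∼_ v u × μ _≤_ (D _≤_ u) x)

RHS : ∀ {n} → Rel n → Rel n → Fin n → VSet n
RHS _≤_ _∼_ v x = N _≤_ _∼_ v x ⊎ μ _≤_ (F _≤_ _∼_ v) x

module Submission where

-- Write  x < y  for the strict tree order and call m a cover of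
-- x below v if x < m < v with nothing strictly between x and m.
--  * Order facts: every x < v is either maximal in D_v or lies in μ(D_m) for
--    some m with x < m < v (take m minimal among such elements, using that
--    a finite partial order is well-founded); and, the order being a tree,
--    x lies in μ(D_u) for at most one u.  These give the disjointness claims.
--  * Graph facts: lefthandedness says exactly that N_v is upward closed inside
--    D_v.  Consequently every element of N_v ∪ μ(F_v) has all of the interval
--    (x, v) inside N_v; combined with the first order fact this gives
--    RHS ⊆ LHS.  Conversely an element of μ(D_v) or of μ(D_u) with u ∈ N_v
--    that is not adjacent to v is maximal in F_v, which gives LHS ⊆ RHS.

open import Defs
open import Data.Nat using (ℕ)
open import Data.Fin using (Fin; _≟_)
open import Data.Fin.Properties using (any?)
open import Data.Fin.Induction using (po-wellFounded)
open import Data.Product using (_×_; _,_; proj₁; proj₂; Σ)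
open import Data.Sum using (_⊎_; inj₁; inj₂)
open import Data.Empty using (⊥-elim)
open import Induction.WellFounded using (Acc; acc)
open import Relation.Binary.Definitions using (Decidable)
open import Relation.Binary.PropositionalEquality using (_≡_; _≢_; refl; sym)
open import Relation.Binary.Structures using (IsPartialOrder)
open import Relation.Nullary using (Dec; yes; no; ¬_)
open import Relation.Nullary.Decidable using (_×-dec_)
import Relation.Binary.Construct.NonStrictToStrict as ToStrict

module TreeOrder {n : ℕ} (_≤_ : Rel n) (_≤?_ : Decidable _≤_) (tree : IsTreeOrder _≤_) where

  _<_ : Rel n
  _<_ = Strict _≤_

  isPartialOrder : IsPartialOrder _≡_ _≤_
  isPartialOrder = proj₁ tree

  <-trans : ∀ {a b c} → a < b → b < c → a < c
  <-trans = ToStrict.<-trans _≡_ _≤_ isPartialOrder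

  _<?_ : Decidable _<_
  _<?_ = ToStrict.<-decidable _≡_ _≤_ _≟_ _≤?_

  comparable : ∀ {x a b} → x < a → x < b → (a ≤ b) ⊎ (b ≤ a)
  comparable {x} {a} {b} = proj₂ tree x a b

  minimal : (P : VSet n) → (∀ x → Dec (P x)) → ∀ {u} → P u →
            Σ (Fin n) λ m → P m × ¬ (Σ (Fin n) λ w → P w × w < m)
  minimal P P? {u} pu = descend u (po-wellFounded isPartialOrder u) pu
    where
      descend : ∀ u → Acc _<_ u → P u →
                Σ (Fin n) λ m → P m × ¬ (Σ (Fin n) λ w → P w × w < m)
      descend u (acc below) pu with any? (λ w → P? w ×-dec (w <? u))
      ... | yes (w , pw , w<u) = descend w (below w<u) pw
      ... | no none = u , pu , none

  maximal-or-covered : ∀ {x v} → x < v →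
    μ _≤_ (D _≤_ v) x ⊎ (Σ (Fin n) λ m → x < m × m < v × μ _≤_ (D _≤_ m) x)
  maximal-or-covered {x} {v} x<v with any? (λ w → (w <? v) ×-dec (x <? w))
  ... | no nothing-between = inj₁ (x<v , λ { (w , w<v , x<w) → nothing-between (w , w<v , x<w) })
  ... | yes (_ , w<v , x<w) with minimal (λ w → w < v × x < w) (λ w → (w <? v) ×-dec (x <? w)) (w<v , x<w)
  ...   | m , (m<v , x<m) , m-minimal =
    inj₂ (m , x<m , m<v , x<m ,
          λ { (w , w<m , x<w) → m-minimal (w , (<-trans w<m m<v , x<w) , w<m) })

  μD-no-between : ∀ {x u v} → μ _≤_ (D _≤_ v) x → x < u → ¬ (u < v)
  μD-no-between (_ , x-max) x<u u<v = x-max (_ , u<v , x<u)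

  μD-unique : ∀ {x u u′} → μ _≤_ (D _≤_ u) x → μ _≤_ (D _≤_ u′) x → u ≡ u′
  μD-unique {u = u} {u′} μx μx′ with u ≟ u′
  ... | yes u≡u′ = u≡u′
  ... | no u≢u′ with comparable (proj₁ μx) (proj₁ μx′)
  ...   | inj₁ u≤u′ = ⊥-elim (μD-no-between μx′ (proj₁ μx) (u≤u′ , u≢u′))
  ...   | inj₂ u′≤u = ⊥-elim (μD-no-between μx (proj₁ μx′) (u′≤u , λ e → u≢u′ (sym e)))

μ-restrict : ∀ {n} (_≤_ : Rel n) {U V : VSet n} → (∀ {w} → V w → U w) →
             ∀ {x} → μ _≤_ U x → V x → μ _≤_ V x
μ-restrict _≤_ V⊆U (_ , x-max) Vx = Vx , λ { (w , Vw , x<w) → x-max (w , V⊆U Vw , x<w) }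

module Lefthanded {n : ℕ} (_≤_ : Rel n) (_∼_ : Rel n)
    (_≤?_ : Decidable _≤_) (_∼?_ : Decidable _∼_)
    (tree : IsTreeOrder _≤_) (graph : IsGraph _∼_) (lefthanded : IsLefthanded _≤_ _∼_)
    (v : Fin n) where

  open TreeOrder _≤_ _≤?_ tree

  ∼-sym : ∀ {a b} → a ∼ b → b ∼ a
  ∼-sym = proj₁ graph _ _

  N-upward : ∀ {x u} → N _≤_ _∼_ v x → x < u → u < v → N _≤_ _∼_ v u
  N-upward (_ , x∼v) x<u u<v = u<v , ∼-sym (proj₂ lefthanded _ _ v x<u u<v (∼-sym x∼v))

  RHS-upward : ∀ {x u} → RHS _≤_ _∼_ v x → x < u → u < v → N _≤_ _∼_ v u
  RHS-upward (inj₁ Nx) x<u u<v = N-upward Nx x<u u<v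
  RHS-upward {u = u} (inj₂ (_ , x-max)) x<u u<v with u ∼? v
  ... | yes u∼v = u<v , u∼v
  ... | no u≁v = ⊥-elim (x-max (u , (u<v , λ Nu → u≁v (proj₂ Nu)) , x<u))

  RHS⊆D : ∀ {x} → RHS _≤_ _∼_ v x → D _≤_ v x
  RHS⊆D (inj₁ (x<v , _)) = x<v
  RHS⊆D (inj₂ ((x<v , _) , _)) = x<v

  N-or-F : ∀ {x} → D _≤_ v x → N _≤_ _∼_ v x ⊎ F _≤_ _∼_ v x
  N-or-F {x} x<v with x ∼? v
  ... | yes x∼v = inj₁ (x<v , x∼v)
  ... | no x≁v = inj₂ (x<v , λ Nx → x≁v (proj₂ Nx))

  -- If x ∈ μ(D_u) for a neighbour u ∈ N_v and x ∈ F_v, then x is maximal in F_v: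
  -- an element w ∈ F_v above x is comparable with u; w < u contradicts the
  -- maximality of x, and u ≤ w puts w into N_v by upward closure.
  μD-neighbour⇒μF : ∀ {x u} → N _≤_ _∼_ v u → μ _≤_ (D _≤_ u) x → F _≤_ _∼_ v x →
                    μ _≤_ (F _≤_ _∼_ v) x
  μD-neighbour⇒μF {x} {u} Nu (x<u , x-max) Fx = Fx , no-larger
    where
      no-larger : ¬ (Σ (Fin n) λ w → F _≤_ _∼_ v w × x < w)
      no-larger (w , (w<v , w∉N) , x<w) with w ≟ u | comparable x<w x<u
      ... | yes refl | _ = w∉N Nu
      ... | no w≢u | inj₁ w≤u = x-max (w , (w≤u , w≢u) , x<w)
      ... | no w≢u | inj₂ u≤w = w∉N (N-upward Nu (u≤w , λ e → w≢u (sym e)) w<v)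

  LHS⊆RHS : ∀ x → LHS _≤_ _∼_ v x → RHS _≤_ _∼_ v x
  LHS⊆RHS x (inj₁ μx) with N-or-F (proj₁ μx)
  ... | inj₁ Nx = inj₁ Nx
  ... | inj₂ Fx = inj₂ (μ-restrict _≤_ proj₁ μx Fx)
  LHS⊆RHS x (inj₂ (u , Nu , μx)) with N-or-F (<-trans (proj₁ μx) (proj₁ Nu))
  ... | inj₁ Nx = inj₁ Nx
  ... | inj₂ Fx = inj₂ (μD-neighbour⇒μF Nu μx Fx)

  RHS⊆LHS : ∀ x → RHS _≤_ _∼_ v x → LHS _≤_ _∼_ v x
  RHS⊆LHS x r with maximal-or-covered (RHS⊆D r)
  ... | inj₁ μx = inj₁ μx
  ... | inj₂ (m , x<m , m<v , μx) = inj₂ (m , RHS-upward r x<m m<v , μx)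

mainTheorem4 : (n : ℕ) (_≤_ : Rel n) (_∼_ : Rel n)
    → Decidable _≤_ → Decidable _∼_
    → IsTreeOrder _≤_ → IsGraph _∼_ → IsLefthanded _≤_ _∼_
    → (v : Fin n)
    → (LHS _≤_ _∼_ v ≐ RHS _≤_ _∼_ v)
      × (∀ (u : Fin n) → N _≤_ _∼_ v u → Disjoint (μ _≤_ (D _≤_ v)) (μ _≤_ (D _≤_ u)))
      × (∀ (u u′ : Fin n) → N _≤_ _∼_ v u → N _≤_ _∼_ v u′ → u ≢ u′
           → Disjoint (μ _≤_ (D _≤_ u)) (μ _≤_ (D _≤_ u′)))
      × Disjoint (N _≤_ _∼_ v) (μ _≤_ (F _≤_ _∼_ v))
mainTheorem4 n _≤_ _∼_ _≤?_ _∼?_ tree graph lefthanded v =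
  (λ x → LHS⊆RHS x , RHS⊆LHS x) ,
  (λ { u (u<v , _) x (μx , (x<u , _)) → μD-no-between μx x<u u<v }) ,
  (λ { u u′ _ _ u≢u′ x (μx , μx′) → u≢u′ (μD-unique μx μx′) }) ,
  (λ { x (Nx , ((_ , x∉N) , _)) → x∉N Nx })
  where
    open TreeOrder _≤_ _≤?_ tree
    open Lefthanded _≤_ _∼_ _≤?_ _∼?_ tree graph lefthanded v
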